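{- Let $A$ be an LM$_\theta$-algebra. Every Boolean congruence of $A$ is both a principal congruence and a $\theta$-congruence of $A$.
   Context: Let $\theta\ge 2$ be the order type of a totally ordered set $J$ with least element $0$, $J=\{0\}+I$ (ordinal sum). An LM$_\theta$-algebra is an algebra $\langle A,\vee,\wedge,0,1,\{\phi_i\}_{i\in I},\{\overline{\phi}_i\}_{i\in I}\rangle$ with $\langle A,\vee,\wedge,0,1\rangle$ a bounded distributive lattice such that for all $i,j\in I$, $x,y\in A$: $\phi_i$ is a bounded lattice endomorphism; $\phi_i x\vee\overline{\phi}_i x=1$, $\phi_i x\wedge\overline{\phi}_i x=0$; $\phi_i\phi_j x=\phi_j x$; $i\le j$ implies $\phi_i x\le\phi_j x$; $\phi_i x=\phi_i y$ for all $i$ implies $x=y$. A Boolean congruence is a congruence having a complement in the lattice of all congruences of $A$; a principal congruence is the least congruence containing some pair $(a,b)$. A $\theta$-congruence is a bounded distributive lattice congruence $\vartheta$ with $(x,y)\in\vartheta$ iff $(\phi_ix,\phi_iy)\in\vartheta$ for all $i\in I$. -}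

module Defs where

open import Level using (Level; suc; _⊔_)
open import Data.Product using (Σ; _×_; _,_; ∃)
open import Relation.Binary.Core using (Rel)
open import Relation.Binary.Structures using (IsEquivalence; IsTotalOrder)
open import Relation.Binary.PropositionalEquality using (_≡_)
open import Algebra.Core using (Op₁; Op₂)
open import Algebra.Lattice.Structures using (IsDistributiveLattice)

-- An LM_θ-algebra. The order type θ ≥ 2 of J = {0} + I is encoded by a
-- totally ordered index set I which is inhabited (θ ≥ 2 iff I ≠ ∅).
record LMAlgebra (a i : Level) : Set (suc (a ⊔ i)) where
  infixr 6 _∨_
  infixr 7 _∧_
  field
    I            : Set i
    _≼_          : Rel I i
    isTotalOrder : IsTotalOrder _≡_ _≼_
    someIndex    : I
    Carrier  : Set a
    _∨_ _∧_  : Op₂ Carrier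
    𝟘 𝟙      : Carrier
    isDistributiveLattice : IsDistributiveLattice _≡_ _∨_ _∧_
    ∨-identity : ∀ x → x ∨ 𝟘 ≡ x
    ∧-identity : ∀ x → x ∧ 𝟙 ≡ x
    φ  : I → Op₁ Carrier
    φ̄  : I → Op₁ Carrier
    φ-∨ : ∀ i x y → φ i (x ∨ y) ≡ φ i x ∨ φ i y
    φ-∧ : ∀ i x y → φ i (x ∧ y) ≡ φ i x ∧ φ i y
    φ-𝟘 : ∀ i → φ i 𝟘 ≡ 𝟘
    φ-𝟙 : ∀ i → φ i 𝟙 ≡ 𝟙
    φ-φ̄-∨ : ∀ i x → φ i x ∨ φ̄ i x ≡ 𝟙
    φ-φ̄-∧ : ∀ i x → φ i x ∧ φ̄ i x ≡ 𝟘
    φφ : ∀ i j x → φ i (φ j x) ≡ φ j x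
    φ-mono : ∀ i j x → i ≼ j → φ i x ∧ φ j x ≡ φ i x
    determination : ∀ x y → (∀ i → φ i x ≡ φ i y) → x ≡ y

module _ {a i : Level} (A : LMAlgebra a i) where
  open LMAlgebra A

  record IsLatticeCongruence (R : Rel Carrier a) : Set a where
    field
      isEquivalence : IsEquivalence R
      ∨-cong : ∀ {x y u v} → R x y → R u v → R (x ∨ u) (y ∨ v)
      ∧-cong : ∀ {x y u v} → R x y → R u v → R (x ∧ u) (y ∧ v)

  record IsCongruence (R : Rel Carrier a) : Set (a ⊔ i) where
    field
      isLatticeCongruence : IsLatticeCongruence R
      φ-cong  : ∀ j {x y} → R x y → R (φ j x) (φ j y)
      φ̄-cong  : ∀ j {x y} → R x y → R (φ̄ j x) (φ̄ j y)

  Congruence : Set (suc a ⊔ i)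
  Congruence = Σ (Rel Carrier a) IsCongruence

  -- R is a complement of S in the lattice of congruences of A:
  -- meet (intersection) is the identity congruence, and the join
  -- (least congruence above both) is the total congruence.
  IsComplementOf : Rel Carrier a → Rel Carrier a → Set (suc a ⊔ i)
  IsComplementOf R S =
    (∀ x y → R x y → S x y → x ≡ y) ×
    (∀ (T : Rel Carrier a) → IsCongruence T →
       (∀ x y → R x y → T x y) → (∀ x y → S x y → T x y) →
       ∀ x y → T x y)

  IsBooleanCongruence : Rel Carrier a → Set (suc a ⊔ i)
  IsBooleanCongruence R =
    IsCongruence R × Σ (Rel Carrier a) (λ S → IsCongruence S × IsComplementOf R S)

  IsPrincipalCongruenceOf : Rel Carrier a → Carrier → Carrier → Set (suc a ⊔ i)
  IsPrincipalCongruenceOf R p q =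
    IsCongruence R × R p q ×
    (∀ (T : Rel Carrier a) → IsCongruence T → T p q → ∀ x y → R x y → T x y)

  IsPrincipalCongruence : Rel Carrier a → Set (suc a ⊔ i)
  IsPrincipalCongruence R = Σ Carrier λ p → Σ Carrier λ q → IsPrincipalCongruenceOf R p q

  IsθCongruence : Rel Carrier a → Set (a ⊔ i)
  IsθCongruence R =
    IsLatticeCongruence R ×
    (∀ x y → R x y → ∀ j → R (φ j x) (φ j y)) ×
    (∀ x y → (∀ j → R (φ j x) (φ j y)) → R x y)

-- A complement S of a congruence R joins with it to the total congruence, so 𝟘 and 𝟙 are linked
-- by a finite R/S-zigzag. Since every φ_j y is complemented (by φ̄_j y), such a zigzag can be
-- folded into one element e with R e 𝟙 and S e 𝟘. Then x ∧ e and y ∧ e are S-related for all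
-- x, y, so R x y forces x ∧ e ≡ y ∧ e (R ∩ S is the identity); conversely x ∧ e ≡ y ∧ e gives
-- R x y from R e 𝟙. Hence R is generated by (e , 𝟙), and the determination principle shows
-- that R reflects the φ_j.
module Submission where

open import Level using (Level)
open import Data.Product using (_×_; _,_; ∃; proj₂)
open import Data.Sum using (inj₁; inj₂)
import Data.Sum as Sum
open import Algebra.Core using (Op₁; Op₂)
open import Relation.Binary.Core using (Rel; _=[_]⇒_)
open import Relation.Binary.Structures using (IsEquivalence)
open import Relation.Binary.Construct.Union using (_∪_)
import Relation.Binary.Construct.Union as Union
open import Relation.Binary.Construct.Closure.ReflexiveTransitive using (Star; ε; _◅_; _◅◅_; gmap; reverse; return)
open import Relation.Binary.PropositionalEquality using (_≡_; sym; trans; cong; subst; module ≡-Reasoning)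
open import Algebra.Lattice.Structures using (IsDistributiveLattice)
open import Defs

module _ {a i : Level} {A : LMAlgebra a i} where
  open LMAlgebra A
  open IsDistributiveLattice isDistributiveLattice using (∧-comm; ∨-comm; absorptive)

  ∧-identityˡ : ∀ x → 𝟙 ∧ x ≡ x
  ∧-identityˡ x = trans (∧-comm 𝟙 x) (∧-identity x)

  ∧-zeroʳ : ∀ x → x ∧ 𝟘 ≡ 𝟘
  ∧-zeroʳ x = begin
    x ∧ 𝟘        ≡⟨ ∧-comm x 𝟘 ⟩
    𝟘 ∧ x        ≡⟨ cong (𝟘 ∧_) (trans (sym (∨-identity x)) (∨-comm x 𝟘)) ⟩
    𝟘 ∧ (𝟘 ∨ x)  ≡⟨ proj₂ absorptive 𝟘 x ⟩
    𝟘            ∎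
    where open ≡-Reasoning

  ∧-agree⇒related : ∀ {T e x y} → IsLatticeCongruence A T → T e 𝟙 → x ∧ e ≡ y ∧ e → T x y
  ∧-agree⇒related {T} {e} {x} {y} cT Te𝟙 x∧e≡y∧e =
    T.trans (T.sym (meet-e-related x)) (subst (λ z → T z y) (sym x∧e≡y∧e) (meet-e-related y))
    where
    module T where
      open IsLatticeCongruence cT public
      open IsEquivalence isEquivalence public
    meet-e-related : ∀ z → T (z ∧ e) z
    meet-e-related z = subst (T (z ∧ e)) (∧-identity z) (T.∧-cong T.refl Te𝟙)

  related⇒∧-agree : ∀ {R S e x y} → IsLatticeCongruence A R → IsLatticeCongruence A S →
    (∀ x y → R x y → S x y → x ≡ y) → S e 𝟘 → R x y → x ∧ e ≡ y ∧ e
  related⇒∧-agree {S = S} {e} {x} {y} cR cS R∩S⊆≡ Se𝟘 Rxy =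
    R∩S⊆≡ _ _ (R.∧-cong Rxy R.refl) (S.trans (meet-e-collapses x) (S.sym (meet-e-collapses y)))
    where
    module R where
      open IsLatticeCongruence cR public
      open IsEquivalence isEquivalence public
    module S where
      open IsLatticeCongruence cS public
      open IsEquivalence isEquivalence public
    meet-e-collapses : ∀ z → S (z ∧ e) 𝟘
    meet-e-collapses z = subst (S (z ∧ e)) (∧-zeroʳ z) (S.∧-cong S.refl Se𝟘)

  φ-∧-agree⇒∧-agree : ∀ {e x y} → (∀ j → φ j x ∧ e ≡ φ j y ∧ e) → x ∧ e ≡ y ∧ e
  φ-∧-agree⇒∧-agree {e} {x} {y} agree = determination _ _ λ j → begin
    φ j (x ∧ e)          ≡⟨ sym (φ-absorbs-φ j x) ⟩
    φ j (φ j x ∧ e)      ≡⟨ cong (φ j) (agree j) ⟩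
    φ j (φ j y ∧ e)      ≡⟨ φ-absorbs-φ j y ⟩
    φ j (y ∧ e)          ∎
    where
    open ≡-Reasoning
    φ-absorbs-φ : ∀ j z → φ j (φ j z ∧ e) ≡ φ j (z ∧ e)
    φ-absorbs-φ j z = begin
      φ j (φ j z ∧ e)        ≡⟨ φ-∧ j (φ j z) e ⟩
      φ j (φ j z) ∧ φ j e    ≡⟨ cong (_∧ φ j e) (φφ j j z) ⟩
      φ j z ∧ φ j e          ≡⟨ sym (φ-∧ j z e) ⟩
      φ j (z ∧ e)            ∎

module Join {a i : Level} {A : LMAlgebra a i} {R S : Rel (LMAlgebra.Carrier A) a}
  (cR : IsCongruence A R) (cS : IsCongruence A S) where
  open LMAlgebra A
  private
    module R where
      open IsCongruence cR public
      open IsLatticeCongruence isLatticeCongruence public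
      open IsEquivalence isEquivalence public
    module S where
      open IsCongruence cS public
      open IsLatticeCongruence isLatticeCongruence public
      open IsEquivalence isEquivalence public

  Join : Rel Carrier a
  Join = Star (R ∪ S)

  private
    preserves : (f : Op₁ Carrier) → R =[ f ]⇒ R → S =[ f ]⇒ S → Join =[ f ]⇒ Join
    preserves f fR fS = gmap f (Sum.map fR fS)

    preserves₂ : (_•_ : Op₂ Carrier) →
      (∀ {x y u v} → R x y → R u v → R (x • u) (y • v)) →
      (∀ {x y u v} → S x y → S u v → S (x • u) (y • v)) →
      ∀ {x y u v} → Join x y → Join u v → Join (x • u) (y • v)
    preserves₂ _•_ •R •S {y = y} {u} xy uv =
      preserves (_• u) (λ r → •R r R.refl) (λ s → •S s S.refl) xy ◅◅
      preserves (y •_) (•R R.refl) (•S S.refl) uv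

  Join-isCongruence : IsCongruence A Join
  Join-isCongruence = record
    { isLatticeCongruence = record
      { isEquivalence = record
        { refl = ε
        ; sym = reverse (Union.symmetric {L = R} {R = S} R.sym S.sym)
        ; trans = _◅◅_
        }
      ; ∨-cong = preserves₂ _∨_ R.∨-cong S.∨-cong
      ; ∧-cong = preserves₂ _∧_ R.∧-cong S.∧-cong
      }
    ; φ-cong = λ j → preserves (φ j) (R.φ-cong j) (S.φ-cong j)
    ; φ̄-cong = λ j → preserves (φ̄ j) (R.φ̄-cong j) (S.φ̄-cong j)
    }

  -- An R-step x ~ y is absorbed into e' = φ_j x ∨ (e ∧ φ̄_j y): modulo R it is φ_j y ∨ φ̄_j y = 𝟙,
  -- modulo S it is φ_j x ∨ (φ_j y ∧ φ̄_j y) = φ_j x.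
  Join-𝟙⇒∃-R-𝟙-S-φ : ∀ j {x} → Join x 𝟙 → ∃ λ e → R e 𝟙 × S e (φ j x)
  Join-𝟙⇒∃-R-𝟙-S-φ j ε = 𝟙 , R.refl , subst (S 𝟙) (sym (φ-𝟙 j)) S.refl
  Join-𝟙⇒∃-R-𝟙-S-φ j (inj₂ Sxy ◅ y~𝟙) with Join-𝟙⇒∃-R-𝟙-S-φ j y~𝟙
  ... | e , Re𝟙 , Seφy = e , Re𝟙 , S.trans Seφy (S.sym (S.φ-cong j Sxy))
  Join-𝟙⇒∃-R-𝟙-S-φ j {x} (_◅_ {j = y} (inj₁ Rxy) y~𝟙) with Join-𝟙⇒∃-R-𝟙-S-φ j y~𝟙
  ... | e , Re𝟙 , Seφy =
    φ j x ∨ (e ∧ φ̄ j y) ,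
    subst (R _) (trans (cong (φ j y ∨_) (∧-identityˡ {A = A} (φ̄ j y))) (φ-φ̄-∨ j y))
      (R.∨-cong (R.φ-cong j Rxy) (R.∧-cong Re𝟙 R.refl)) ,
    subst (S _) (trans (cong (φ j x ∨_) (φ-φ̄-∧ j y)) (∨-identity (φ j x)))
      (S.∨-cong S.refl (S.∧-cong Seφy S.refl))

module _ {a i : Level} {A : LMAlgebra a i} where
  open LMAlgebra A

  Boolean⇒∃-generator : ∀ {R} → IsBooleanCongruence A R →
    ∃ λ e → R e 𝟙 × (∀ {x y} → R x y → x ∧ e ≡ y ∧ e)
  Boolean⇒∃-generator (cR , S , cS , R∩S⊆≡ , R∨S-total)
    with Join-𝟙⇒∃-R-𝟙-S-φ someIndex (R∨S-total Join Join-isCongruence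
           (λ _ _ r → return (inj₁ r)) (λ _ _ s → return (inj₂ s)) 𝟘 𝟙)
    where open Join cR cS
  ... | e , Re𝟙 , Seφ𝟘 = e , Re𝟙 ,
    related⇒∧-agree (IsCongruence.isLatticeCongruence cR) (IsCongruence.isLatticeCongruence cS)
      R∩S⊆≡ (subst (S e) (φ-𝟘 someIndex) Seφ𝟘)

corollary4p12 : ∀ {a i : Level} (A : LMAlgebra a i) (R : Rel (LMAlgebra.Carrier A) a) →
    IsBooleanCongruence A R → IsPrincipalCongruence A R × IsθCongruence A R
corollary4p12 A R boolean@(cR , _) with Boolean⇒∃-generator boolean
... | e , Re𝟙 , agree =
  (e , 𝟙 , cR , Re𝟙 , λ T cT Te𝟙 _ _ Rxy → ∧-agree⇒related (isLatticeCongruence cT) Te𝟙 (agree Rxy)) ,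
  isLatticeCongruence cR ,
  (λ _ _ Rxy j → φ-cong cR j Rxy) ,
  λ _ _ Rφ → ∧-agree⇒related (isLatticeCongruence cR) Re𝟙 (φ-∧-agree⇒∧-agree {A = A} (λ j → agree (Rφ j)))
  where
  open LMAlgebra A using (𝟙)
  open IsCongruence
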